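{- Let $G$ be a finite abelian group, $S=\{s,-s,s',-s',s_0\}\subseteq G\setminus\{0\}$ a generating set of $G$ with $|S|=5$, $o(s_0)=2$ and $o(s),o(s')>2$, and $\Gamma=\mathrm{Cay}(G,S)$. For integers $i,j,k$ let $x(i,j,k)=is+js'+ks_0$. Let $D$ be a perfect code of $\Gamma$. Then one of the following holds: (i) $x(i+1,j+1,k+1)\in D$ for all $x(i,j,k)\in D$; (ii) $x(i-1,j+1,k+1)\in D$ for all $x(i,j,k)\in D$.
   Context: $\mathrm{Cay}(G,S)$ has vertex set $G$ with $x\sim y$ iff $y-x\in S$. A perfect code is a vertex set $C$ such that every vertex is at distance at most $1$ from exactly one vertex of $C$. $o(x)$ is the order of $x$. -}

module Defs where

open import Level using (Level; _⊔_)
open import Data.Nat using (ℕ; zero; suc)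
open import Data.Integer using (ℤ; +_; -[1+_])
open import Data.List using (List; _∷_; [])
open import Data.List.Relation.Unary.Any using (Any)
open import Data.Product using (Σ; ∃; _×_; _,_)
open import Data.Sum using (_⊎_)
open import Relation.Unary using (Pred)
open import Relation.Nullary using (¬_)
open import Algebra.Bundles using (AbelianGroup)

module _ {c ℓ : Level} (G : AbelianGroup c ℓ) where
  open AbelianGroup G

  natMul : ℕ → Carrier → Carrier
  natMul zero    x = ε
  natMul (suc n) x = x ∙ natMul n x

  intMul : ℤ → Carrier → Carrier
  intMul (+ n)    x = natMul n x
  intMul -[1+ n ] x = (natMul (suc n) x) ⁻¹

  IsFinite : Set (c ⊔ ℓ)
  IsFinite = Σ (List Carrier) (λ l → ∀ x → Any (x ≈_) l)

  data InSubgroupGen {p : Level} (S : Pred Carrier p) : Carrier → Set (c ⊔ ℓ ⊔ p) where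
    gen  : ∀ {x} → S x → InSubgroupGen S x
    unit : InSubgroupGen S ε
    mul  : ∀ {x y} → InSubgroupGen S x → InSubgroupGen S y → InSubgroupGen S (x ∙ y)
    inv  : ∀ {x} → InSubgroupGen S x → InSubgroupGen S (x ⁻¹)
    resp : ∀ {x y} → x ≈ y → InSubgroupGen S x → InSubgroupGen S y

  Generates : {p : Level} → Pred Carrier p → Set (c ⊔ ℓ ⊔ p)
  Generates S = ∀ g → InSubgroupGen S g

  ListSet : List Carrier → Pred Carrier (c ⊔ ℓ)
  ListSet l g = Any (g ≈_) l

  CayAdj : {p : Level} → Pred Carrier p → Carrier → Carrier → Set p
  CayAdj S x y = S (y ∙ x ⁻¹)

  DistLe1 : {p : Level} → Pred Carrier p → Carrier → Carrier → Set (ℓ ⊔ p)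
  DistLe1 S x y = x ≈ y ⊎ CayAdj S x y

  IsPerfectCode : {p q : Level} → Pred Carrier p → Pred Carrier q → Set (c ⊔ ℓ ⊔ p ⊔ q)
  IsPerfectCode S D = ∀ g → Σ Carrier (λ d → D d × DistLe1 S d g ×
                         (∀ d' → D d' → DistLe1 S d' g → d' ≈ d))

  OrderTwo : Carrier → Set ℓ
  OrderTwo x = (¬ x ≈ ε) × (x ∙ x) ≈ ε

  OrderGt2 : Carrier → Set ℓ
  OrderGt2 x = (¬ x ≈ ε) × (¬ (x ∙ x) ≈ ε)

{-# OPTIONS --safe #-}
module Submission where

-- Map the lattice ℤ² × ℤ/2 onto G by (i , j , k) ↦ i s + j s' + k s₀; the
-- closed neighbourhood of a vertex is the image of a six-point ball, and two
-- codewords whose lattice balls overlap at a point reached by different dist⇒step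
-- contradict perfectness.  A finite search in the lattice shows that every
-- codeword c has a type: c ± (s + s' + s₀) ∈ D or c ± (-s + s' + s₀) ∈ D.
-- Two codewords with adjacent neighbourhoods but different types would always
-- produce such an overlap, so the type of the codeword covering v does not
-- change when v moves along an edge, and it is constant because S generates G.

open import Defs
open import Level using (Level)
open import Data.Integer using (ℤ; _+_; _-_; +_)
open import Data.List using (List; _∷_; [])
open import Data.Product using (_×_)
open import Data.Sum using (_⊎_)
open import Relation.Unary using (Pred)
open import Relation.Nullary using (¬_)
open import Algebra.Bundles using (AbelianGroup)

open import Data.Bool using (Bool; true; false; _xor_; if_then_else_)
import Data.Bool.Properties as Boolₚ
open import Data.Empty using (⊥; ⊥-elim)
open import Data.Integer as ℤ using (-[1+_]; -_; ∣_∣)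
import Data.Integer.Properties as ℤₚ
open import Data.List using (map; filter; length; concatMap; foldr)
open import Data.List.Membership.Propositional using (_∈_; find; lose)
open import Data.List.Membership.Propositional.Properties using (∈-map⁺; ∈-filter⁺)
import Data.List.Membership.DecPropositional as DecMembership
open import Data.List.Relation.Binary.Pointwise using (Pointwise; []; _∷_)
open import Data.List.Relation.Unary.All as All using (All; []; _∷_; all?)
open import Data.List.Relation.Unary.AllPairs using (AllPairs; []; _∷_)
open import Data.List.Relation.Unary.Any as Any using (Any; here; there; any?)
open import Data.Maybe as Maybe using (Maybe; just; nothing; from-just)
open import Data.Nat as ℕ using (ℕ; zero; suc)
import Data.Nat.Properties as ℕₚ
open import Data.Product using (∃; _,_; proj₁; proj₂)
open import Data.Product.Properties using (≡-dec)
open import Data.Sum as Sum using (inj₁; inj₂; [_,_]′)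
open import Function using (_∘_; id)
open import Relation.Binary.Bundles using (Setoid)
open import Relation.Binary.Definitions using (DecidableEquality)
open import Relation.Binary.PropositionalEquality using (_≡_; _≢_; refl; cong; cong₂)
open import Relation.Nullary using (Dec; yes; no; ¬?; _×-dec_; _⊎-dec_)
open import Relation.Nullary.Decidable using (from-yes)

module IntegerMultiples {c ℓ} (G : AbelianGroup c ℓ) where
  open AbelianGroup G
  open import Algebra.Properties.AbelianGroup G using (⁻¹-∙-comm; ε⁻¹≈ε)
  open import Algebra.Properties.CommutativeSemigroup commutativeSemigroup using (interchange)
  open import Relation.Binary.Reasoning.Setoid setoid

  natMul-+ : ∀ m n x → natMul G (m ℕ.+ n) x ≈ natMul G m x ∙ natMul G n x
  natMul-+ zero    n x = sym (identityˡ _)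
  natMul-+ (suc m) n x = trans (∙-congˡ (natMul-+ m n x)) (sym (assoc _ _ _))

  intMul-⊖ : ∀ m n x → intMul G (m ℤ.⊖ n) x ≈ natMul G m x ∙ natMul G n x ⁻¹
  intMul-⊖ m       zero    x = sym (trans (∙-congˡ ε⁻¹≈ε) (identityʳ _))
  intMul-⊖ zero    (suc n) x = sym (identityˡ _)
  intMul-⊖ (suc m) (suc n) x = begin
    intMul G (suc m ℤ.⊖ suc n) x                    ≡⟨ cong (λ i → intMul G i x) (ℤₚ.[1+m]⊖[1+n]≡m⊖n m n) ⟩
    intMul G (m ℤ.⊖ n) x                            ≈⟨ intMul-⊖ m n x ⟩
    natMul G m x ∙ natMul G n x ⁻¹                  ≈⟨ identityˡ _ ⟨
    ε ∙ (natMul G m x ∙ natMul G n x ⁻¹)            ≈⟨ ∙-congʳ (inverseʳ x) ⟨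
    (x ∙ x ⁻¹) ∙ (natMul G m x ∙ natMul G n x ⁻¹)   ≈⟨ interchange _ _ _ _ ⟩
    (x ∙ natMul G m x) ∙ (x ⁻¹ ∙ natMul G n x ⁻¹)   ≈⟨ ∙-congˡ (⁻¹-∙-comm _ _) ⟩
    natMul G (suc m) x ∙ natMul G (suc n) x ⁻¹      ∎

  intMul-+ : ∀ i j x → intMul G (i + j) x ≈ intMul G i x ∙ intMul G j x
  intMul-+ (+ m)    (+ n)    x = natMul-+ m n x
  intMul-+ (+ m)    -[1+ n ] x = intMul-⊖ m (suc n) x
  intMul-+ -[1+ m ] (+ n)    x = trans (intMul-⊖ n (suc m) x) (comm _ _)
  intMul-+ -[1+ m ] -[1+ n ] x = begin
    natMul G (suc (suc (m ℕ.+ n))) x ⁻¹             ≡⟨ cong (λ k → natMul G (suc k) x ⁻¹) (ℕₚ.+-suc m n) ⟨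
    natMul G (suc m ℕ.+ suc n) x ⁻¹                 ≈⟨ ⁻¹-cong (natMul-+ (suc m) (suc n) x) ⟩
    (natMul G (suc m) x ∙ natMul G (suc n) x) ⁻¹    ≈⟨ ⁻¹-∙-comm _ _ ⟨
    natMul G (suc m) x ⁻¹ ∙ natMul G (suc n) x ⁻¹   ∎

module Translation {c ℓ p q} (G : AbelianGroup c ℓ) {S : Pred (AbelianGroup.Carrier G) p}
  (Q : Pred (AbelianGroup.Carrier G) q) where
  open AbelianGroup G
  open import Algebra.Properties.AbelianGroup G using (ε⁻¹≈ε; ⁻¹-involutive; ⁻¹-anti-homo-∙)

  translate± : (∀ {u v} → u ≈ v → Q u → Q v) →
               (∀ {g v} → S g → Q v → Q (v ∙ g) × Q (v ∙ g ⁻¹)) →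
               ∀ {g} → InSubgroupGen G S g → ∀ {v} → Q v → Q (v ∙ g) × Q (v ∙ g ⁻¹)
  translate± Q-resp Q-step = go
    where
    go : ∀ {g} → InSubgroupGen G S g → ∀ {v} → Q v → Q (v ∙ g) × Q (v ∙ g ⁻¹)
    go (gen Sg) = Q-step Sg
    go unit qv = Q-resp (sym (identityʳ _)) qv
               , Q-resp (sym (trans (∙-congˡ ε⁻¹≈ε) (identityʳ _))) qv
    go (mul {x} {y} hx hy) qv =
      Q-resp (assoc _ _ _) (proj₁ (go hy (proj₁ (go hx qv)))) ,
      Q-resp (trans (assoc _ _ _) (∙-congˡ (sym (⁻¹-anti-homo-∙ x y)))) (proj₂ (go hx (proj₂ (go hy qv))))
    go (inv hx) qv =
      proj₂ (go hx qv) , Q-resp (∙-congˡ (sym (⁻¹-involutive _))) (proj₁ (go hx qv))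
    go (resp x≈y hx) qv =
      Q-resp (∙-congˡ x≈y) (proj₁ (go hx qv)) , Q-resp (∙-congˡ (⁻¹-cong x≈y)) (proj₂ (go hx qv))

module ListImage {a c ℓ} {A : Set a} (S : Setoid c ℓ) (f : A → Setoid.Carrier S) where
  open Setoid S using (_≈_; sym; trans)

  image : ∀ {xs ys x} → Pointwise (λ x y → f x ≈ y) xs ys → x ∈ xs → Any (f x ≈_) ys
  image (r ∷ _)  (here refl) = here r
  image (_ ∷ rs) (there x∈)  = there (image rs x∈)

  preimage : ∀ {xs ys z} → Pointwise (λ x y → f x ≈ y) xs ys → Any (z ≈_) ys → Any (λ x → z ≈ f x) xs
  preimage (r ∷ _)  (here z≈y) = here (trans z≈y (sym r))
  preimage (_ ∷ rs) (there z∈) = there (preimage rs z∈)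

  private
    avoids : ∀ {y z ys} → All (λ y' → ¬ y ≈ y') ys → Any (z ≈_) ys → ¬ y ≈ z
    avoids (y≉ ∷ _) (here z≈) y≈z = y≉ (trans y≈z z≈)
    avoids (_ ∷ ne) (there z∈)    = avoids ne z∈

  injectiveOn : ∀ {xs ys x x'} → Pointwise (λ x y → f x ≈ y) xs ys →
                AllPairs (λ y y' → ¬ y ≈ y') ys → x ∈ xs → x' ∈ xs → f x ≈ f x' → x ≡ x'
  injectiveOn _        _        (here refl) (here refl) _  = refl
  injectiveOn (r ∷ rs) (ne ∷ _) (here refl) (there x'∈) eq = ⊥-elim (avoids ne (image rs x'∈) (trans (sym r) eq))
  injectiveOn (r ∷ rs) (ne ∷ _) (there x∈)  (here refl) eq = ⊥-elim (avoids ne (image rs x∈) (trans (sym r) (sym eq)))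
  injectiveOn (_ ∷ rs) (_ ∷ ne) (there x∈)  (there x'∈) eq = injectiveOn rs ne x∈ x'∈ eq

Offset : Set
Offset = ℤ × ℤ × Bool

infix 4 _≟_
_≟_ : DecidableEquality Offset
_≟_ = ≡-dec ℤₚ._≟_ (≡-dec ℤₚ._≟_ Boolₚ._≟_)

open DecMembership _≟_ using (_∈?_)

infixl 6 _⊕_ _⊖_
infix  8 ⊝_

_⊕_ : Offset → Offset → Offset
(i , j , b) ⊕ (i' , j' , b') = i + i' , j + j' , b xor b'

⊝_ : Offset → Offset
⊝ (i , j , b) = - i , - j , b

_⊖_ : Offset → Offset → Offset
o ⊖ o' = o ⊕ ⊝ o'

𝟎 e₁ e₂ e₃ diag₁ diag₂ : Offset
𝟎 = + 0 , + 0 , false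
e₁ = + 1 , + 0 , false
e₂ = + 0 , + 1 , false
e₃ = + 0 , + 0 , true
diag₁ = e₁ ⊕ e₂ ⊕ e₃
diag₂ = ⊝ e₁ ⊕ e₂ ⊕ e₃

⊕-inverseʳ : ∀ o → o ⊕ ⊝ o ≡ 𝟎
⊕-inverseʳ (i , j , b) = cong₂ _,_ (ℤₚ.+-inverseʳ i) (cong₂ _,_ (ℤₚ.+-inverseʳ j) (Boolₚ.xor-same b))

ball : List Offset
ball = 𝟎 ∷ e₁ ∷ ⊝ e₁ ∷ e₂ ∷ ⊝ e₂ ∷ e₃ ∷ []

⊝-ball : ∀ {t} → t ∈ ball → ⊝ t ∈ ball
⊝-ball = All.lookup (from-yes (all? (λ t → ⊝ t ∈? ball) ball))

Clash : Offset → Offset → Set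
Clash o o' = Any (λ t → Any (λ t' → o ⊕ t ≡ o' ⊕ t' × t ≢ t') ball) ball

clash? : ∀ o o' → Dec (Clash o o')
clash? o o' = any? (λ t → any? (λ t' → (o ⊕ t ≟ o' ⊕ t') ×-dec ¬? (t ≟ t')) ball) ball

Conflict : List Offset → Set
Conflict K = Any (λ o → Any (Clash o) K) K

conflict? : ∀ K → Dec (Conflict K)
conflict? K = any? (λ o → any? (clash? o) K) K

clear? : ∀ K c → Dec (All (λ k → ¬ Clash c k) K)
clear? K c = all? (λ k → ¬? (clash? c k)) K

candidates : List Offset → Offset → List Offset
candidates K p = filter (clear? K) (map (p ⊖_) ball)

-- Which point to split on only affects the size of the search, not its
-- soundness: take the uncovered point within distance 3 with fewest candidates.
pick : List Offset → Offset
pick K = proj₁ (foldr fewer (𝟎 , 7) (filter (¬? ∘ covered?) region))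
  where
  fewer : Offset → Offset × ℕ → Offset × ℕ
  fewer p (q , n) = let m = length (candidates K p) in if m ℕ.<ᵇ n then (p , m) else (q , n)
  covered? : ∀ p → Dec (Any (λ t → p ⊖ t ∈ K) ball)
  covered? p = any? (λ t → p ⊖ t ∈? K) ball
  size : Offset → ℕ
  size (i , j , b) = ∣ i ∣ ℕ.+ ∣ j ∣ ℕ.+ (if b then 1 else 0)
  window : List ℤ
  window = + 3 ∷ -[1+ 2 ] ∷ + 2 ∷ -[1+ 1 ] ∷ + 1 ∷ -[1+ 0 ] ∷ + 0 ∷ []
  region : List Offset
  region = filter (λ o → size o ℕ.≤? 3)
    (concatMap (λ i → concatMap (λ j → (i , j , false) ∷ (i , j , true) ∷ []) window) window)

-- A refutation-style search tree over the known codewords K: a point with no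
-- candidates closes its branch.
data Closed (Goal : List Offset → Set) (K : List Offset) : Set where
  done  : Goal K → Closed Goal K
  split : ∀ p → All (λ c → Closed Goal (c ∷ K)) (candidates K p) → Closed Goal K

module Search (Goal : List Offset → Set) (goal? : ∀ K → Dec (Goal K)) where
  search    : ℕ → ∀ K → Maybe (Closed Goal K)
  searchAll : ℕ → ∀ K cs → Maybe (All (λ c → Closed Goal (c ∷ K)) cs)
  searchGoal : ℕ → ∀ K → Dec (Goal K) → Maybe (Closed Goal K)

  search n K = searchGoal n K (goal? K)

  searchGoal n       K (yes g) = just (done g)
  searchGoal zero    K (no _)  = nothing
  searchGoal (suc n) K (no _)  = Maybe.map (split (pick K)) (searchAll n K (candidates K (pick K)))

  searchAll n K []       = just []
  searchAll n K (c ∷ cs) = Maybe.zipWith _∷_ (search n (c ∷ K)) (searchAll n K cs)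

TypeKnown : List Offset → Set
TypeKnown K = (diag₁ ∈ K × ⊝ diag₁ ∈ K) ⊎ (diag₂ ∈ K × ⊝ diag₂ ∈ K)

typeKnown? : ∀ K → Dec (TypeKnown K)
typeKnown? K = (diag₁ ∈? K ×-dec ⊝ diag₁ ∈? K) ⊎-dec (diag₂ ∈? K ×-dec ⊝ diag₂ ∈? K)

typeSearch : Closed TypeKnown (𝟎 ∷ [])
typeSearch = from-just (Search.search TypeKnown typeKnown? 6 (𝟎 ∷ []))

-- Codewords 𝟎 of type A and o of type B whose neighbourhoods are adjacent,
-- i.e. o = t ⊕ e ⊖ t' with t, e, t' in the ball.
configuration : Offset → Offset → Offset → List Offset
configuration A B o = 𝟎 ∷ A ∷ ⊝ A ∷ o ∷ o ⊕ B ∷ o ⊖ B ∷ []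

MixedTypes : Offset → Offset → Set
MixedTypes A B =
  All (λ t → All (λ e → All (λ t' → Conflict (configuration A B (t ⊕ e ⊖ t'))) ball) ball) ball

mixedTypes? : ∀ A B → Dec (MixedTypes A B)
mixedTypes? A B =
  all? (λ t → all? (λ e → all? (λ t' → conflict? (configuration A B (t ⊕ e ⊖ t'))) ball) ball) ball

mixed₁₂ : MixedTypes diag₁ diag₂
mixed₁₂ = from-yes (mixedTypes? diag₁ diag₂)

mixed₂₁ : MixedTypes diag₂ diag₁
mixed₂₁ = from-yes (mixedTypes? diag₂ diag₁)

module LocallyPerfect {q} (InCode : Offset → Set q)
  (covered : ∀ p → Any (λ t → InCode (p ⊖ t)) ball)
  (separated : ∀ {o o'} → InCode o → InCode o' → ¬ Clash o o') where

  conflict-free : ∀ {K} → All InCode K → ¬ Conflict K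
  conflict-free cws conflict =
    let cw , clashes = All.lookupAny cws conflict
        cw' , clash  = All.lookupAny cws clashes
    in separated cw cw' clash

  candidate : ∀ {K} → All InCode K → ∀ p → Any InCode (candidates K p)
  candidate {K} cws p =
    let t , t∈ , cw = find (covered p)
    in lose (∈-filter⁺ (clear? K) (∈-map⁺ (p ⊖_) t∈) (All.map (separated cw) cws)) cw

  module _ {r} {Goal : List Offset → Set} {R : Set r} (read : ∀ {K} → All InCode K → Goal K → R) where
    sound : ∀ {K} → Closed Goal K → All InCode K → R
    soundBranch : ∀ {K cs} → All (λ c → Closed Goal (c ∷ K)) cs → Any InCode cs → All InCode K → R

    sound (done g)           cws = read cws g
    sound (split p branches) cws = soundBranch branches (candidate cws p) cws

    soundBranch (b ∷ _)  (here cw) cws = sound b (cw ∷ cws)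
    soundBranch (_ ∷ bs) (there c) cws = soundBranch bs c cws

  typed : InCode 𝟎 → (InCode diag₁ × InCode (⊝ diag₁)) ⊎ (InCode diag₂ × InCode (⊝ diag₂))
  typed cw𝟎 = sound read typeSearch (cw𝟎 ∷ [])
    where
    read : ∀ {K} → All InCode K → TypeKnown K → (InCode diag₁ × InCode (⊝ diag₁)) ⊎ (InCode diag₂ × InCode (⊝ diag₂))
    read cws = Sum.map (λ (p , q) → All.lookup cws p , All.lookup cws q)
                       (λ (p , q) → All.lookup cws p , All.lookup cws q)

module PerfectCodes {c ℓ} (G : AbelianGroup c ℓ) (s s' s₀ : AbelianGroup.Carrier G)
  (s₀-square : AbelianGroup._≈_ G (AbelianGroup._∙_ G s₀ s₀) (AbelianGroup.ε G)) where
  open AbelianGroup G hiding (_-_; refl) renaming (reflexive to ≡⇒≈)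
  open import Algebra.Properties.AbelianGroup G using (inverseʳ-unique; xyx⁻¹≈y; x≈y⇒x∙y⁻¹≈ε; ∙-cancelˡ)
  open import Algebra.Properties.CommutativeSemigroup commutativeSemigroup using (interchange)
  open import Relation.Binary.Reasoning.Setoid setoid
  open IntegerMultiples G using (intMul-+)

  x : ℤ → ℤ → ℤ → Carrier
  x i j k = intMul G i s ∙ (intMul G j s' ∙ intMul G k s₀)

  parity : Bool → ℤ
  parity false = + 0
  parity true  = + 1

  -- ⟦_⟧ is not injective, so lattice arguments only ever conclude from
  -- equalities of offsets, never from equalities in G.
  ⟦_⟧ : Offset → Carrier
  ⟦ i , j , b ⟧ = x i j (parity b)

  x-homo : ∀ i j k i' j' k' → x (i + i') (j + j') (k + k') ≈ x i j k ∙ x i' j' k'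
  x-homo i j k i' j' k' = begin
    intMul G (i + i') s ∙ (intMul G (j + j') s' ∙ intMul G (k + k') s₀)
      ≈⟨ ∙-cong (intMul-+ i i' s) (∙-cong (intMul-+ j j' s') (intMul-+ k k' s₀)) ⟩
    (intMul G i s ∙ intMul G i' s) ∙ ((intMul G j s' ∙ intMul G j' s') ∙ (intMul G k s₀ ∙ intMul G k' s₀))
      ≈⟨ ∙-congˡ (interchange _ _ _ _) ⟩
    (intMul G i s ∙ intMul G i' s) ∙ ((intMul G j s' ∙ intMul G k s₀) ∙ (intMul G j' s' ∙ intMul G k' s₀))
      ≈⟨ interchange _ _ _ _ ⟩
    x i j k ∙ x i' j' k' ∎

  intMul-parity : ∀ b b' → intMul G (parity (b xor b')) s₀ ≈ intMul G (parity b + parity b') s₀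
  intMul-parity true  true  = sym (trans (∙-congˡ (identityʳ s₀)) s₀-square)
  intMul-parity true  false = ≡⇒≈ refl
  intMul-parity false true  = ≡⇒≈ refl
  intMul-parity false false = ≡⇒≈ refl

  ⟦⟧-homo : ∀ o o' → ⟦ o ⊕ o' ⟧ ≈ ⟦ o ⟧ ∙ ⟦ o' ⟧
  ⟦⟧-homo (i , j , b) (i' , j' , b') =
    trans (∙-congˡ (∙-congˡ (intMul-parity b b'))) (x-homo i j (parity b) i' j' (parity b'))

  ⟦𝟎⟧ : ⟦ 𝟎 ⟧ ≈ ε
  ⟦𝟎⟧ = trans (identityˡ _) (identityˡ _)

  ∙⟦𝟎⟧ : ∀ g → g ∙ ⟦ 𝟎 ⟧ ≈ g
  ∙⟦𝟎⟧ g = trans (∙-congˡ ⟦𝟎⟧) (identityʳ g)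

  ∙⟦⊕⟧ : ∀ g o o' → g ∙ ⟦ o ⊕ o' ⟧ ≈ g ∙ ⟦ o ⟧ ∙ ⟦ o' ⟧
  ∙⟦⊕⟧ g o o' = trans (∙-congˡ (⟦⟧-homo o o')) (sym (assoc _ _ _))

  ⟦⊝⟧ : ∀ o → ⟦ ⊝ o ⟧ ≈ ⟦ o ⟧ ⁻¹
  ⟦⊝⟧ o = inverseʳ-unique ⟦ o ⟧ ⟦ ⊝ o ⟧
    (trans (sym (⟦⟧-homo o (⊝ o))) (trans (≡⇒≈ (cong ⟦_⟧ (⊕-inverseʳ o))) ⟦𝟎⟧))

  moved : ∀ {g g'} u u' → g ∙ ⟦ u ⟧ ≈ g' ∙ ⟦ u' ⟧ → g' ≈ g ∙ ⟦ u ⊖ u' ⟧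
  moved {g} {g'} u u' eq = sym (begin
    g ∙ ⟦ u ⊖ u' ⟧          ≈⟨ ∙⟦⊕⟧ g u (⊝ u') ⟩
    g ∙ ⟦ u ⟧ ∙ ⟦ ⊝ u' ⟧    ≈⟨ ∙-congʳ eq ⟩
    g' ∙ ⟦ u' ⟧ ∙ ⟦ ⊝ u' ⟧  ≈⟨ ∙⟦⊕⟧ g' u' (⊝ u') ⟨
    g' ∙ ⟦ u' ⊖ u' ⟧        ≡⟨ cong (λ o → g' ∙ ⟦ o ⟧) (⊕-inverseʳ u') ⟩
    g' ∙ ⟦ 𝟎 ⟧              ≈⟨ ∙⟦𝟎⟧ g' ⟩
    g'                      ∎)

  open ListImage setoid ⟦_⟧

  gens : List Carrier
  gens = ε ∷ s ∷ s ⁻¹ ∷ s' ∷ s' ⁻¹ ∷ s₀ ∷ []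

  ⟦ball⟧ : Pointwise (λ t g → ⟦ t ⟧ ≈ g) ball gens
  ⟦ball⟧ = ⟦𝟎⟧
         ∷ trans (on-s (+ 1)) (identityʳ s)
         ∷ trans (on-s -[1+ 0 ]) (⁻¹-cong (identityʳ s))
         ∷ trans (on-s' (+ 1)) (identityʳ s')
         ∷ trans (on-s' -[1+ 0 ]) (⁻¹-cong (identityʳ s'))
         ∷ trans (identityˡ _) (trans (identityˡ _) (identityʳ s₀))
         ∷ []
    where
    on-s : ∀ i → x i (+ 0) (+ 0) ≈ intMul G i s
    on-s i = trans (∙-congˡ (identityˡ ε)) (identityʳ _)
    on-s' : ∀ j → x (+ 0) j (+ 0) ≈ intMul G j s'
    on-s' j = trans (identityˡ _) (identityʳ _)

  module Code {q} (distinct : AllPairs (λ a b → ¬ a ≈ b) gens)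
    (D : Pred Carrier q) (D-resp : ∀ {a b} → a ≈ b → D a → D b)
    (perfect : IsPerfectCode G (ListSet G (s ∷ s ⁻¹ ∷ s' ∷ s' ⁻¹ ∷ s₀ ∷ [])) D) where

    S : Pred Carrier _
    S = ListSet G (s ∷ s ⁻¹ ∷ s' ∷ s' ⁻¹ ∷ s₀ ∷ [])

    step⇒dist : ∀ {c g t} → t ∈ ball → g ≈ c ∙ ⟦ t ⟧ → DistLe1 G S c g
    step⇒dist {c} {g} {t} t∈ g≈ with image ⟦ball⟧ t∈
    ... | here ⟦t⟧≈ε  = inj₁ (sym (trans g≈ (trans (∙-congˡ ⟦t⟧≈ε) (identityʳ c))))
    ... | there ⟦t⟧∈S = inj₂ (Any.map (trans (trans (∙-congʳ g≈) (xyx⁻¹≈y c ⟦ t ⟧))) ⟦t⟧∈S)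

    dist⇒step : ∀ {c g} → DistLe1 G S c g → Any (λ t → g ≈ c ∙ ⟦ t ⟧) ball
    dist⇒step {c} {g} c~g = Any.map solve (preimage ⟦ball⟧ (toGens c~g))
      where
      toGens : DistLe1 G S c g → Any ((g ∙ c ⁻¹) ≈_) gens
      toGens (inj₁ c≈g) = here (x≈y⇒x∙y⁻¹≈ε (sym c≈g))
      toGens (inj₂ adj) = there adj
      solve : ∀ {y} → g ∙ c ⁻¹ ≈ y → g ≈ c ∙ y
      solve e = sym (trans (∙-congˡ (sym e)) (trans (sym (assoc _ _ _)) (xyx⁻¹≈y c g)))

    covering : ∀ g → ∃ λ d → D d × Any (λ t → g ≈ d ∙ ⟦ t ⟧) ball
    covering g = let d , Dd , d~g , _ = perfect g in d , Dd , dist⇒step d~g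

    unique : ∀ {a b g} → D a → D b → DistLe1 G S a g → DistLe1 G S b g → a ≈ b
    unique {g = g} Da Db a~g b~g =
      let _ , _ , _ , only = perfect g in trans (only _ Da a~g) (sym (only _ Db b~g))

    dist⇒step-agree : ∀ {a b t t'} → D a → D b → t ∈ ball → t' ∈ ball → a ∙ ⟦ t ⟧ ≈ b ∙ ⟦ t' ⟧ → t ≡ t'
    dist⇒step-agree {a} {b} Da Db t∈ t'∈ eq =
      injectiveOn ⟦ball⟧ distinct t∈ t'∈ (∙-cancelˡ a _ _ (trans eq (∙-congʳ (sym a≈b))))
      where
      a≈b : a ≈ b
      a≈b = unique Da Db (step⇒dist t∈ (≡⇒≈ refl)) (step⇒dist t'∈ eq)

    Codeword : Carrier → Offset → Set q
    Codeword c o = D (c ∙ ⟦ o ⟧)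

    covered : ∀ c p → Any (λ t → Codeword c (p ⊖ t)) ball
    covered c p = let d , Dd , cov = covering (c ∙ ⟦ p ⟧) in Any.map (λ {t} eq → D-resp (moved p t eq) Dd) cov

    separated : ∀ c {o o'} → Codeword c o → Codeword c o' → ¬ Clash o o'
    separated c {o} {o'} cw cw' clash =
      let t , t∈ , meets = find clash
          t' , t'∈ , o⊕t≡o'⊕t' , t≢t' = find meets
      in t≢t' (dist⇒step-agree cw cw' t∈ t'∈ (begin
           c ∙ ⟦ o ⟧ ∙ ⟦ t ⟧      ≈⟨ ∙⟦⊕⟧ c o t ⟨
           c ∙ ⟦ o ⊕ t ⟧          ≡⟨ cong (λ u → c ∙ ⟦ u ⟧) o⊕t≡o'⊕t' ⟩
           c ∙ ⟦ o' ⊕ t' ⟧        ≈⟨ ∙⟦⊕⟧ c o' t' ⟩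
           c ∙ ⟦ o' ⟧ ∙ ⟦ t' ⟧    ∎))

    module At (c : Carrier) = LocallyPerfect (Codeword c) (covered c) (λ {o} {o'} → separated c {o} {o'})

    HasType : Offset → Carrier → Set q
    HasType A c = D (c ∙ ⟦ A ⟧) × D (c ∙ ⟦ ⊝ A ⟧)

    HasType-resp : ∀ {A c c'} → c ≈ c' → HasType A c → HasType A c'
    HasType-resp c≈c' (p , n) = D-resp (∙-congʳ c≈c') p , D-resp (∙-congʳ c≈c') n

    typeOf : ∀ {c} → D c → HasType diag₁ c ⊎ HasType diag₂ c
    typeOf {c} Dc = At.typed c (D-resp (sym (∙⟦𝟎⟧ c)) Dc)

    module UniformType (A B : Offset) (typeOf' : ∀ {c} → D c → HasType A c ⊎ HasType B c)
      (mixed : MixedTypes A B) where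

      CoveredByType : Pred Carrier _
      CoveredByType v = ∃ λ c → D c × HasType A c × Any (λ t → v ≈ c ∙ ⟦ t ⟧) ball

      CoveredByType-resp : ∀ {u v} → u ≈ v → CoveredByType u → CoveredByType v
      CoveredByType-resp u≈v (c , Dc , τ , cov) = c , Dc , τ , Any.map (trans (sym u≈v)) cov

      adjacent : ∀ {v e} → e ∈ ball → CoveredByType v → CoveredByType (v ∙ ⟦ e ⟧)
      adjacent {v} {e} e∈ (c , Dc , τ , cov) with covering (v ∙ ⟦ e ⟧)
      ... | c' , Dc' , cov' = c' , Dc' , [ id , ⊥-elim ∘ ofTypeB ]′ (typeOf' Dc') , cov'
        where
        ofTypeB : HasType B c' → ⊥
        ofTypeB (σ , σ⁻) =
          let t , t∈ , v≈ = find cov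
              t' , t'∈ , ve≈ = find cov'
              o = t ⊕ e ⊖ t'
              c'≈ : c' ≈ c ∙ ⟦ o ⟧
              c'≈ = moved (t ⊕ e) t' (trans (∙⟦⊕⟧ c t e) (trans (∙-congʳ (sym v≈)) ve≈))
              shifted : ∀ u → D (c' ∙ ⟦ u ⟧) → Codeword c (o ⊕ u)
              shifted u = D-resp (trans (∙-congʳ c'≈) (sym (∙⟦⊕⟧ c o u)))
          in At.conflict-free c
               (D-resp (sym (∙⟦𝟎⟧ c)) Dc ∷ proj₁ τ ∷ proj₂ τ ∷ D-resp c'≈ Dc'
                 ∷ shifted B σ ∷ shifted (⊝ B) σ⁻ ∷ [])
               (All.lookup (All.lookup (All.lookup mixed t∈) e∈) t'∈)

      generator : ∀ {g v} → S g → CoveredByType v → CoveredByType (v ∙ g) × CoveredByType (v ∙ g ⁻¹)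
      generator Sg cov =
        let e , e∈ , g≈ = find (preimage ⟦ball⟧ (there Sg))
        in CoveredByType-resp (∙-congˡ (sym g≈)) (adjacent e∈ cov)
         , CoveredByType-resp (∙-congˡ (trans (⟦⊝⟧ e) (⁻¹-cong (sym g≈)))) (adjacent (⊝-ball e∈) cov)

      uniform : Generates G S → CoveredByType ε → ∀ {g} → D g → HasType A g
      uniform generates covε {g} Dg =
        let c , Dc , τ , cov = CoveredByType-resp (identityˡ g)
              (proj₁ (Translation.translate± G CoveredByType CoveredByType-resp generator (generates g) covε))
            t , t∈ , g≈ = find cov
        in HasType-resp {A} (unique Dc Dg (step⇒dist t∈ g≈) (step⇒dist (here refl) (sym (∙⟦𝟎⟧ g)))) τ

    translationInvariant : Generates G S →
        (∀ i j k → D (x i j k) → D (x (i + + 1) (j + + 1) (k + + 1)))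
      ⊎ (∀ i j k → D (x i j k) → D (x (i - + 1) (j + + 1) (k + + 1)))
    translationInvariant generates =
      let d , Dd , cov = covering ε
      in Sum.map
           (λ τ i j k Dx → D-resp (sym (x-homo i j k (+ 1) (+ 1) (+ 1)))
              (proj₁ (UniformType.uniform diag₁ diag₂ typeOf mixed₁₂ generates (d , Dd , τ , cov) Dx)))
           (λ τ i j k Dx → D-resp (sym (x-homo i j k -[1+ 0 ] (+ 1) (+ 1)))
              (proj₁ (UniformType.uniform diag₂ diag₁ (Sum.swap ∘ typeOf) mixed₂₁ generates (d , Dd , τ , cov) Dx)))
           (typeOf Dd)

lemma3p5 : {c ℓ q : Level} (G : AbelianGroup c ℓ)
    → IsFinite G
    → (s s' s₀ : AbelianGroup.Carrier G)
    → let open AbelianGroup G hiding (_-_)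
          S = ListSet G (s ∷ s ⁻¹ ∷ s' ∷ s' ⁻¹ ∷ s₀ ∷ [])
          x = λ (i j k : ℤ) → intMul G i s ∙ (intMul G j s' ∙ intMul G k s₀)
      in
      -- S ⊆ G ∖ {0}
      (¬ s ≈ ε) → (¬ s ⁻¹ ≈ ε) → (¬ s' ≈ ε) → (¬ s' ⁻¹ ≈ ε) → (¬ s₀ ≈ ε)
      -- |S| = 5 : the five listed elements are pairwise distinct
      → (¬ s ≈ s ⁻¹) → (¬ s ≈ s') → (¬ s ≈ s' ⁻¹) → (¬ s ≈ s₀)
      → (¬ s ⁻¹ ≈ s') → (¬ s ⁻¹ ≈ s' ⁻¹) → (¬ s ⁻¹ ≈ s₀)
      → (¬ s' ≈ s' ⁻¹) → (¬ s' ≈ s₀) → (¬ s' ⁻¹ ≈ s₀)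
      -- S generates G
      → Generates G S
      -- o(s₀) = 2, o(s) > 2, o(s') > 2
      → OrderTwo G s₀ → OrderGt2 G s → OrderGt2 G s'
      -- D is a perfect code of Cay(G,S) (a subset of G, closed under ≈)
      → (D : Pred Carrier q)
      → (∀ {a b} → a ≈ b → D a → D b)
      → IsPerfectCode G S D
      → (∀ i j k → D (x i j k) → D (x (i + + 1) (j + + 1) (k + + 1)))
        ⊎ (∀ i j k → D (x i j k) → D (x (i - + 1) (j + + 1) (k + + 1)))
lemma3p5 G _ s s' s₀ s≉ε s⁻¹≉ε s'≉ε s'⁻¹≉ε s₀≉ε
         s≉s⁻¹ s≉s' s≉s'⁻¹ s≉s₀ s⁻¹≉s' s⁻¹≉s'⁻¹ s⁻¹≉s₀ s'≉s'⁻¹ s'≉s₀ s'⁻¹≉s₀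
         generates (_ , s₀-square) _ _ D D-resp perfect =
  PerfectCodes.Code.translationInvariant G s s' s₀ s₀-square distinct D D-resp perfect generates
  where
  open AbelianGroup G using (_≈_; _⁻¹; ε; sym)
  distinct : AllPairs (λ a b → ¬ a ≈ b) (ε ∷ s ∷ s ⁻¹ ∷ s' ∷ s' ⁻¹ ∷ s₀ ∷ [])
  distinct = ((s≉ε ∘ sym) ∷ (s⁻¹≉ε ∘ sym) ∷ (s'≉ε ∘ sym) ∷ (s'⁻¹≉ε ∘ sym) ∷ (s₀≉ε ∘ sym) ∷ [])
           ∷ (s≉s⁻¹ ∷ s≉s' ∷ s≉s'⁻¹ ∷ s≉s₀ ∷ [])
           ∷ (s⁻¹≉s' ∷ s⁻¹≉s'⁻¹ ∷ s⁻¹≉s₀ ∷ [])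
           ∷ (s'≉s'⁻¹ ∷ s'≉s₀ ∷ [])
           ∷ (s'⁻¹≉s₀ ∷ [])
           ∷ []
           ∷ []
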